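{- Let $\Gamma$ be a finite simplicial graph. Consider the regular grammar with terminal alphabet $V\Gamma$, one variable $\mathbf{\Delta}_\sigma$ for each clique $\sigma$ of $\Gamma$, start variable $\mathbf{\Delta}_\varnothing$, and production rules $\mathbf{\Delta}_\sigma\to u\,\mathbf{\Delta}_{\tau\cup\{u\}}$ for every clique $\sigma$, every $\tau\subseteq\sigma$ and every $u\in\mathrm{Lk}(\sigma;\tau)$, together with $\mathbf{\Delta}_\sigma\to\varepsilon$ for every clique $\sigma$. This grammar is unambiguous, and every variable is reachable from the start variable.
   Context: A clique is a vertex set spanning a complete subgraph (including $\varnothing$). For a clique $\sigma$ and $\tau\subseteq\sigma$, $\mathrm{Lk}(\sigma;\tau)=\{v\in V\Gamma\setminus\sigma\mid\mathrm{Lk}(v)\cap\sigma=\tau\}$, where $\mathrm{Lk}(v)$ is the set of neighbours of $v$. In a regular grammar, $x\mathbf{A}$ yields $x\alpha$ if $\mathbf{A}\to\alpha$ is a rule, and derivations are sequences of yields. The grammar is unambiguous if every terminal word derivable from the start variable has a unique derivation; a variable $\mathbf{A}$ is reachable if some string containing $\mathbf{A}$ can be derived from the start variable. -}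

module Defs where

open import Data.Nat using (ℕ)
open import Data.Bool using (Bool; true; false)
open import Data.Fin using (Fin)
open import Data.Fin.Subset using (Subset; _∈_; _∉_; _⊆_; _∩_; _∪_; ⁅_⁆; ⊥)
open import Data.Vec using (tabulate)
open import Data.List using (List; []; _∷_; _++_)
open import Data.Maybe using (Maybe; just; nothing)
open import Data.Product using (Σ; ∃; _×_; _,_)
open import Relation.Binary.PropositionalEquality using (_≡_; _≢_)
open import Relation.Nullary using (¬_)
open import Data.Empty using (⊥-elim)
open import Data.Fin.Subset.Properties using (∉⊥)

record Graph (n : ℕ) : Set where
  field
    adj    : Fin n → Fin n → Bool
    sym    : ∀ u v → adj u v ≡ adj v u
    irrefl : ∀ v → adj v v ≡ false

module _ {n : ℕ} (Γ : Graph n) where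
  open Graph Γ

  Lk : Fin n → Subset n
  Lk v = tabulate (adj v)

  IsClique : Subset n → Set
  IsClique σ = ∀ u v → u ∈ σ → v ∈ σ → u ≢ v → adj u v ≡ true

  -- cliques; the clique proof is irrelevant, so a clique is determined by its vertex set
  record Clique : Set where
    constructor clique
    field
      verts      : Subset n
      .isClique  : IsClique verts
  open Clique public

  _∈Lk[_∶_] : Fin n → Subset n → Subset n → Set
  u ∈Lk[ σ ∶ τ ] = (u ∉ σ) × (Lk u ∩ σ ≡ τ)

-- Regular grammars.  Every rule has the form A → w B or A → w
-- (w a terminal word).  Sentential forms arising in a regular grammar are
-- x A or x, represented as (x , just A) and (x , nothing).

record RegularGrammar (T : Set) : Set₁ where
  field
    Var   : Set
    start : Var
    Rule  : Var → List T × Maybe Var → Set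

module _ {T : Set} (G : RegularGrammar T) where
  open RegularGrammar G

  Form : Set
  Form = List T × Maybe Var

  data Yields : Form → Form → Set where
    yields : ∀ x A w m → Rule A (w , m) → Yields (x , just A) (x ++ w , m)

  data Derivation : Form → Form → Set where
    done : ∀ {s} → Derivation s s
    step : ∀ {s s′ t} → Yields s s′ → Derivation s′ t → Derivation s t

  forms : ∀ {s t} → Derivation s t → List Form
  forms {s} done       = s ∷ []
  forms {s} (step _ d) = s ∷ forms d

  startForm : Form
  startForm = [] , just start

  Unambiguous : Set
  Unambiguous = ∀ (w : List T) (d₁ d₂ : Derivation startForm (w , nothing)) →
                forms d₁ ≡ forms d₂

  Reachable : Var → Set
  Reachable A = ∃ λ (x : List T) → Derivation startForm (x , just A)

module _ {n : ℕ} (Γ : Graph n) where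

  data CliqueRule : Clique Γ → List (Fin n) × Maybe (Clique Γ) → Set where
    extend : ∀ σ τ u (ρ : Clique Γ) →
             τ ⊆ verts σ → _∈Lk[_∶_] Γ u (verts σ) τ →
             verts ρ ≡ τ ∪ ⁅ u ⁆ →
             CliqueRule σ (u ∷ [] , just ρ)
    stop   : ∀ σ → CliqueRule σ ([] , nothing)

  emptyClique : Clique Γ
  emptyClique = clique ⊥ (λ u v u∈ _ _ → ⊥-elim (∉⊥ u∈))

  cliqueGrammar : RegularGrammar (Fin n)
  cliqueGrammar = record
    { Var   = Clique Γ
    ; start = emptyClique
    ; Rule  = CliqueRule
    }

-- The grammar is a deterministic automaton in disguise: every rule emits at most
-- one letter, and from Δ_σ the letter u forces the target Δ_{τ ∪ {u}} with
-- τ = Lk(u) ∩ σ.  So a derivation of a word is read off the word letter by letter,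
-- the ε-rule being forced exactly at its end.  Conversely, if v ∉ σ and σ ∪ {v} is
-- a clique then v ∈ Lk(σ;σ), so Δ_σ → v Δ_{σ ∪ {v}}; removing vertices one at a
-- time from a clique (strong induction on ⊂) therefore reaches it from Δ_∅.

module Submission where

open import Defs
open import Data.Bool using (true; _≟_)
open import Data.Fin using (Fin; zero; suc)
import Data.Fin.Properties as Fin
open import Data.Fin.Subset using (Subset; _∈_; _∉_; _⊆_; _⊂_; _∩_; _∪_; _-_; ⁅_⁆)
open import Data.Fin.Subset.Properties
  using (⊆-refl; ⊆-antisym; p∩q⊆q; x∈p∩q⁺; p⊆p∪q; q⊆p∪q; x∈p∪q⁻; x∈⁅x⁆; x∈⁅y⁆⇒x≡y;
         p─q⊆p; x∈p∧x≢y⇒x∈p-y; x∈p⇒p-x⊂p; nonempty?; Empty-unique)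
open import Data.Fin.Subset.Induction using (⊂-wellFounded)
open import Data.List using (List; []; _∷_; _++_)
open import Data.List.Properties using (++-assoc; ++-identityʳ; ++-cancelˡ; ∷-injectiveˡ)
open import Data.Maybe using (Maybe; just; nothing)
open import Data.Nat using (ℕ)
open import Data.Product using (_×_; _,_; ∃)
open import Data.Sum using (inj₁; inj₂)
open import Data.Vec as Vec using (tabulate; there)
open import Data.Vec.Properties using (lookup⇒[]=; lookup∘tabulate)
open import Induction.WellFounded using (Acc; acc)
open import Relation.Binary.PropositionalEquality
open import Relation.Nullary using (yes; no)
open import Relation.Nullary.Decidable using (recompute)

x∉p-x : ∀ {n} (p : Subset n) x → x ∉ p - x
x∉p-x (_ Vec.∷ p) zero    ()
x∉p-x (_ Vec.∷ p) (suc x) (there x∈p-x) = x∉p-x p x x∈p-x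

x∈p⇒p≡p-x∪x : ∀ {n} {p : Subset n} {x} → x ∈ p → p ≡ (p - x) ∪ ⁅ x ⁆
x∈p⇒p≡p-x∪x {p = p} {x} x∈p = ⊆-antisym ⊆-split ⊇-split
  where
  ⊆-split : p ⊆ (p - x) ∪ ⁅ x ⁆
  ⊆-split {y} y∈p with y Fin.≟ x
  ... | yes refl = q⊆p∪q _ _ (x∈⁅x⁆ x)
  ... | no y≢x   = p⊆p∪q _ (x∈p∧x≢y⇒x∈p-y y∈p y≢x)

  ⊇-split : (p - x) ∪ ⁅ x ⁆ ⊆ p
  ⊇-split y∈ with x∈p∪q⁻ (p - x) ⁅ x ⁆ y∈
  ... | inj₁ y∈p-x = p─q⊆p p ⁅ x ⁆ y∈p-x
  ... | inj₂ y∈x   = subst (_∈ p) (sym (x∈⁅y⁆⇒x≡y x y∈x)) x∈p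

module _ {T : Set} (G : RegularGrammar T) where
  open RegularGrammar G

  data RuleShape : List T × Maybe Var → Set where
    halt : RuleShape ([] , nothing)
    emit : ∀ u B → RuleShape (u ∷ [] , just B)

  record IsDeterministic : Set where
    field
      ruleShape      : ∀ {A α} → Rule A α → RuleShape α
      emitFunctional : ∀ {A u B C} → Rule A (u ∷ [] , just B) → Rule A (u ∷ [] , just C) → B ≡ C

  derivation-extends : ∀ {x m w m′} → Derivation G (x , m) (w , m′) → ∃ λ r → w ≡ x ++ r
  derivation-extends {x} done = [] , sym (++-identityʳ x)
  derivation-extends (step (yields x _ v _ _) d) with derivation-extends d
  ... | r , w≡xvr = v ++ r , trans w≡xvr (++-assoc x v r)

  derivation-extends-letter : ∀ {x u m w m′} → Derivation G (x ++ u ∷ [] , m) (w , m′) →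
                              ∃ λ r → w ≡ x ++ u ∷ r
  derivation-extends-letter {x} {u} d with derivation-extends d
  ... | r , w≡xur = r , trans w≡xur (++-assoc x (u ∷ []) r)

  derivation-from-terminal : ∀ {x t} → Derivation G (x , nothing) t → t ≡ (x , nothing)
  derivation-from-terminal done = refl

  derivation-snoc : ∀ {s t t′} → Derivation G s t → Yields G t t′ → Derivation G s t′
  derivation-snoc done        y = step y done
  derivation-snoc (step y′ d) y = step y′ (derivation-snoc d y)

  deterministic⇒forms-unique : IsDeterministic → ∀ {s w} (d₁ d₂ : Derivation G s (w , nothing)) →
                               forms G d₁ ≡ forms G d₂
  deterministic⇒forms-unique det = unique
    where
    open IsDeterministic det

    unique : ∀ {s w} (d₁ d₂ : Derivation G s (w , nothing)) → forms G d₁ ≡ forms G d₂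
    unique done done = refl
    unique done (step () _)
    unique (step () _) done
    unique (step (yields x _ _ _ r₁) d₁) (step (yields _ _ _ _ r₂) d₂) with ruleShape r₁ | ruleShape r₂
    ... | halt | halt = cong (_ ∷_) (unique d₁ d₂)
    ... | halt | emit u B with derivation-from-terminal d₁ | derivation-extends-letter d₂
    ...   | refl | r , x++[]≡x++ur with ++-cancelˡ x [] (u ∷ r) x++[]≡x++ur
    ...     | ()
    unique (step (yields x _ _ _ r₁) d₁) (step (yields _ _ _ _ r₂) d₂)
      | emit u B | halt with derivation-from-terminal d₂ | derivation-extends-letter d₁
    ...   | refl | r , x++[]≡x++ur with ++-cancelˡ x [] (u ∷ r) x++[]≡x++ur
    ...     | ()
    unique (step (yields x _ _ _ r₁) d₁) (step (yields _ _ _ _ r₂) d₂)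
      | emit u₁ B₁ | emit u₂ B₂ with derivation-extends-letter d₁ | derivation-extends-letter d₂
    ...   | r₁′ , w≡xu₁r₁ | r₂′ , w≡xu₂r₂
      with ∷-injectiveˡ (++-cancelˡ x (u₁ ∷ r₁′) (u₂ ∷ r₂′) (trans (sym w≡xu₁r₁) w≡xu₂r₂))
    ...     | refl with emitFunctional r₁ r₂
    ...       | refl = cong (_ ∷_) (unique d₁ d₂)

  deterministic⇒unambiguous : IsDeterministic → Unambiguous G
  deterministic⇒unambiguous det _ = deterministic⇒forms-unique det

module _ {n : ℕ} (Γ : Graph n) where
  open Graph Γ using (adj)

  private
    G = cliqueGrammar Γ

  clique-ext : {σ ρ : Clique Γ} → verts σ ≡ verts ρ → σ ≡ ρ
  clique-ext {clique _ _} {clique _ _} refl = refl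

  -- The clique proof is irrelevant, but equality of booleans is decidable.
  clique-isClique : (σ : Clique Γ) → IsClique Γ (verts σ)
  clique-isClique (clique _ σ-clique) u v u∈σ v∈σ u≢v = recompute (adj u v ≟ true) (σ-clique u v u∈σ v∈σ u≢v)

  adj⇒∈Lk : ∀ {u v} → adj u v ≡ true → v ∈ Lk Γ u
  adj⇒∈Lk {u} {v} uv = lookup⇒[]= v (tabulate (adj u)) (trans (lookup∘tabulate (adj u) v) uv)

  cliqueGrammar-isDeterministic : IsDeterministic G
  cliqueGrammar-isDeterministic = record { ruleShape = shape ; emitFunctional = functional }
    where
    shape : ∀ {σ α} → CliqueRule Γ σ α → RuleShape G α
    shape (extend _ _ u ρ _ _ _) = emit u ρ
    shape (stop _)               = halt

    functional : ∀ {σ u ρ₁ ρ₂} → CliqueRule Γ σ (u ∷ [] , just ρ₁) → CliqueRule Γ σ (u ∷ [] , just ρ₂) →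
                 ρ₁ ≡ ρ₂
    functional {u = u} {ρ₁} {ρ₂} (extend _ τ₁ _ _ _ (_ , Lk∩σ≡τ₁) ρ₁≡) (extend _ τ₂ _ _ _ (_ , Lk∩σ≡τ₂) ρ₂≡) =
      clique-ext (begin
        verts ρ₁      ≡⟨ ρ₁≡ ⟩
        τ₁ ∪ ⁅ u ⁆    ≡⟨ cong (_∪ ⁅ u ⁆) (trans (sym Lk∩σ≡τ₁) Lk∩σ≡τ₂) ⟩
        τ₂ ∪ ⁅ u ⁆    ≡⟨ sym ρ₂≡ ⟩
        verts ρ₂      ∎)
      where open ≡-Reasoning

  Lk∩-clique : ∀ (ρ : Clique Γ) {v p} → v ∈ verts ρ → p ⊆ verts ρ → v ∉ p → Lk Γ v ∩ p ≡ p
  Lk∩-clique ρ v∈ρ p⊆ρ v∉p = ⊆-antisym (p∩q⊆q _ _) (λ w∈p →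
    x∈p∩q⁺ (adj⇒∈Lk (clique-isClique ρ _ _ v∈ρ (p⊆ρ w∈p) (λ { refl → v∉p w∈p })) , w∈p))

  reachable-extend : ∀ (σ ρ : Clique Γ) {v} → v ∉ verts σ → verts ρ ≡ verts σ ∪ ⁅ v ⁆ →
                     Reachable G σ → Reachable G ρ
  reachable-extend σ ρ {v} v∉σ ρ≡σ∪v (x , d) =
    x ++ v ∷ [] , derivation-snoc G d (yields x σ (v ∷ []) (just ρ)
      (extend σ (verts σ) v ρ ⊆-refl (v∉σ , Lk∩σ≡σ) ρ≡σ∪v))
    where
    Lk∩σ≡σ : Lk Γ v ∩ verts σ ≡ verts σ
    Lk∩σ≡σ = Lk∩-clique ρ (subst (v ∈_) (sym ρ≡σ∪v) (q⊆p∪q _ _ (x∈⁅x⁆ v)))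
                         (λ w∈σ → subst (_ ∈_) (sym ρ≡σ∪v) (p⊆p∪q _ w∈σ)) v∉σ

  removeVertex : Clique Γ → Fin n → Clique Γ
  removeVertex σ v = clique (verts σ - v)
    (λ u w u∈ w∈ → clique-isClique σ u w (p─q⊆p _ _ u∈) (p─q⊆p _ _ w∈))

  reachable-acc : ∀ (σ : Clique Γ) → Acc _⊂_ (verts σ) → Reachable G σ
  reachable-acc σ (acc smaller) with nonempty? (verts σ)
  ... | no σ-empty = [] , subst (λ ρ → Derivation G (startForm G) ([] , just ρ)) emptyClique≡σ done
    where
    emptyClique≡σ : emptyClique Γ ≡ σ
    emptyClique≡σ = clique-ext (sym (Empty-unique σ-empty))
  ... | yes (v , v∈σ) =
    reachable-extend (removeVertex σ v) σ (x∉p-x (verts σ) v) (x∈p⇒p≡p-x∪x v∈σ)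
      (reachable-acc (removeVertex σ v) (smaller (x∈p⇒p-x⊂p v∈σ)))

  cliqueGrammar-reachable : ∀ (σ : Clique Γ) → Reachable G σ
  cliqueGrammar-reachable σ = reachable-acc σ (⊂-wellFounded (verts σ))

lemma6p6 : ∀ {n : ℕ} (Γ : Graph n) →
    Unambiguous (cliqueGrammar Γ) × (∀ (σ : Clique Γ) → Reachable (cliqueGrammar Γ) σ)
lemma6p6 Γ = deterministic⇒unambiguous (cliqueGrammar Γ) (cliqueGrammar-isDeterministic Γ)
           , cliqueGrammar-reachable Γ
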